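{- Let $\Sigma$ be an action signature and let $\alpha,\beta$ be simple actions of $\mathcal L_1(\Sigma)$. If $\alpha\equiv\beta$ (i.e. some syntactic bisimulation relates $\alpha$ and $\beta$), then for every sentence $\varphi$ of $\mathcal L_1(\Sigma)$, $\vdash[\alpha]\varphi\leftrightarrow[\beta]\varphi$ in the logical system for $\mathcal L_1(\Sigma)$.
   Context: Fix AtSen and Agents. An action signature $\Sigma$: a finite set with relations $\to_A$ and an enumeration $\sigma_1,\dots,\sigma_n$. $\mathcal L_1(\Sigma)$: sentences $\mathsf{true}\mid p\mid\neg\varphi\mid\varphi\wedge\psi\mid\Box_A\varphi\mid\Box^*_B\varphi\mid[\pi]\varphi$; programs $\mathsf{skip}\mid\mathsf{crash}\mid\sigma_i\psi_1\cdots\psi_n\mid\pi\cup\rho\mid\pi;\rho$. $\langle\pi\rangle=\neg[\pi]\neg$. Simple actions: programs without $\cup$. $\Omega$: simple actions with the smallest relations $\to_A$ such that $\mathsf{skip}\to_A\mathsf{skip}$, $\sigma_i\vec\varphi\to_A\sigma_j\vec\psi$ iff $\sigma_i\to_A\sigma_j$ in $\Sigma$ and $\vec\varphi=\vec\psi$, and $\alpha;\beta\to_A\alpha';\beta'$ whenever $\alpha\to_A\alpha'$, $\beta\to_A\beta'$; $\to^*_C$ the reflexive-transitive closure of $\bigcup_{A\in C}\to_A$. $\mathrm{Pre}(\mathsf{skip})=\mathsf{true}$, $\mathrm{Pre}(\mathsf{crash})=\mathsf{false}$, $\mathrm{Pre}(\sigma_i\vec\psi)=\psi_i$, $\mathrm{Pre}(\alpha;\beta)=\langle\alpha\rangle\mathrm{Pre}(\beta)$.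 A syntactic bisimulation is a relation $R$ on simple actions such that whenever $\alpha R\beta$: $\vdash\mathrm{Pre}(\alpha)\leftrightarrow\mathrm{Pre}(\beta)$; for every $A$ and $\alpha'$ with $\alpha\to_A\alpha'$ there is $\beta'$ with $\beta\to_A\beta'$ and $\alpha'R\beta'$; and for every $A$ and $\beta'$ with $\beta\to_A\beta'$ there is $\alpha'$ with $\alpha\to_A\alpha'$ and $\alpha'R\beta'$. Logical system for $\mathcal L_1(\Sigma)$: axioms: propositional tautologies; $K$-normality for $[\pi]$, $\Box_A$, $\Box^*_C$; Atomic Permanence $[\sigma_i\vec\psi]p\leftrightarrow(\psi_i\to p)$; Partial Functionality $[\sigma_i\vec\psi]\neg\chi\leftrightarrow(\psi_i\to\neg[\sigma_i\vec\psi]\chi)$; Action-Knowledge $[\sigma_i\vec\psi]\Box_A\varphi\leftrightarrow(\psi_i\to\bigwedge\{\Box_A[\sigma_j\vec\psi]\varphi:\sigma_i\to_A\sigma_j\})$; Epistemic Mix $\Box^*_C\varphi\to\varphi\wedge\bigwedge_{A\in C}\Box_A\Box^*_C\varphi$; Skip $[\mathsf{skip}]\varphi\leftrightarrow\varphi$; Crash $[\mathsf{crash}]\mathsf{false}$; Composition $[\pi][\rho]\varphi\leftrightarrow[\pi;\rho]\varphi$; Choice $[\pi\cup\rho]\varphi\leftrightarrow[\pi]\varphi\wedge[\rho]\varphi$. Rules: modus ponens; necessitation for $[\pi]$, $\Box_A$, $\Box^*_C$; Action Rule: for simple $\alpha$, sentence $\psi$, $C$, sentences $\chi_\beta$ for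 $\alpha\to^*_C\beta$: from $\vdash\chi_\beta\to[\beta]\psi$ and $\vdash(\chi_\beta\wedge\mathrm{Pre}(\beta))\to\Box_A\chi_\gamma$ ($A\in C$, $\beta\to_A\gamma$) infer $\vdash\chi_\alpha\to[\alpha]\Box^*_C\psi$. -}

module Defs where

open import Data.Nat using (ℕ)
open import Data.Fin using (Fin)
open import Data.Bool using (Bool; true; false; not; _∧_)
open import Data.List using (List; []; _∷_; foldr; map; filterᵇ; allFin)
open import Data.List.Membership.Propositional using (_∈_)
open import Data.Vec using (Vec; lookup)
open import Data.Product using (Σ; _×_; ∃; ∃-syntax; _,_)
open import Relation.Binary.PropositionalEquality using (_≡_)

-- An action signature over a set of agents: a finite set of action types,
-- enumerated as σ₁ … σₙ (represented by Fin n), with a (decidable, hence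
-- Bool-valued) relation →_A on it for every agent A.
record Signature (Agents : Set) : Set where
  field
    size : ℕ
    arr  : Agents → Fin size → Fin size → Bool   -- arr A i j = true  iff  σᵢ →_A σⱼ

module L₁ (AtSen Agents : Set) (Sig : Signature Agents) where
  open Signature Sig renaming (size to n)

  infix 9 ¬ₛ_
  infixr 6 _⋀_
  infixr 5 _⇒_
  infix 4 _⇔_
  infix 8 [_]_ ⟨_⟩_
  infix 2 ⊢_

  -- Sentences and programs of L₁(Σ).  Groups C are finite sets of agents,
  -- represented by lists.
  mutual
    data Sen : Set where
      ⊤ₛ    : Sen
      atom  : AtSen → Sen
      ¬ₛ_   : Sen → Sen
      _⋀_   : Sen → Sen → Sen
      □     : Agents → Sen → Sen
      □*    : List Agents → Sen → Sen
      [_]_  : Prog → Sen → Sen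

    data Prog : Set where
      skip  : Prog
      crash : Prog
      act   : Fin n → Vec Sen n → Prog
      _∪_   : Prog → Prog → Prog
      _⨟_   : Prog → Prog → Prog

  ⊥ₛ : Sen
  ⊥ₛ = ¬ₛ ⊤ₛ

  _⇒_ : Sen → Sen → Sen
  φ ⇒ ψ = ¬ₛ (φ ⋀ ¬ₛ ψ)

  _⇔_ : Sen → Sen → Sen
  φ ⇔ ψ = (φ ⇒ ψ) ⋀ (ψ ⇒ φ)

  ⟨_⟩_ : Prog → Sen → Sen
  ⟨ π ⟩ φ = ¬ₛ ([ π ] (¬ₛ φ))

  ⋀ₗ : List Sen → Sen
  ⋀ₗ = foldr _⋀_ ⊤ₛ

  data SAct : Set where
    skip  : SAct
    crash : SAct
    act   : Fin n → Vec Sen n → SAct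
    _⨟_   : SAct → SAct → SAct

  ⌜_⌝ : SAct → Prog
  ⌜ skip ⌝    = skip
  ⌜ crash ⌝   = crash
  ⌜ act i ψs ⌝ = act i ψs
  ⌜ α ⨟ β ⌝   = ⌜ α ⌝ ⨟ ⌜ β ⌝

  data _⟶[_]_ : SAct → Agents → SAct → Set where
    skip→ : ∀ {A} → skip ⟶[ A ] skip
    act→  : ∀ {A i j ψs} → arr A i j ≡ true → act i ψs ⟶[ A ] act j ψs
    seq→  : ∀ {A α α′ β β′} → α ⟶[ A ] α′ → β ⟶[ A ] β′ → (α ⨟ β) ⟶[ A ] (α′ ⨟ β′)

  data _⟶*[_]_ : SAct → List Agents → SAct → Set where
    refl* : ∀ {C α} → α ⟶*[ C ] α
    step* : ∀ {C α β γ A} → A ∈ C → α ⟶[ A ] β → β ⟶*[ C ] γ → α ⟶*[ C ] γ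

  Pre : SAct → Sen
  Pre skip       = ⊤ₛ
  Pre crash      = ⊥ₛ
  Pre (act i ψs) = lookup ψs i
  Pre (α ⨟ β)    = ⟨ ⌜ α ⌝ ⟩ Pre β

  eval : (Sen → Bool) → Sen → Bool
  eval v ⊤ₛ       = true
  eval v (¬ₛ φ)   = not (eval v φ)
  eval v (φ ⋀ ψ)  = eval v φ ∧ eval v ψ
  eval v φ@(atom _)  = v φ
  eval v φ@(□ _ _)   = v φ
  eval v φ@(□* _ _)  = v φ
  eval v φ@([ _ ] _) = v φ

  Tautology : Sen → Set
  Tautology φ = ∀ (v : Sen → Bool) → eval v φ ≡ true

  AKconj : Fin n → Vec Sen n → Agents → Sen → Sen
  AKconj i ψs A φ = ⋀ₗ (map (λ j → □ A ([ act j ψs ] φ)) (filterᵇ (arr A i) (allFin n)))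

  data ⊢_ : Sen → Set where
    taut      : ∀ {φ} → Tautology φ → ⊢ φ
    K-prog    : ∀ π φ ψ → ⊢ ([ π ] (φ ⇒ ψ)) ⇒ (([ π ] φ) ⇒ ([ π ] ψ))
    K-box     : ∀ A φ ψ → ⊢ (□ A (φ ⇒ ψ)) ⇒ ((□ A φ) ⇒ (□ A ψ))
    K-cbox    : ∀ C φ ψ → ⊢ (□* C (φ ⇒ ψ)) ⇒ ((□* C φ) ⇒ (□* C ψ))
    atomic-permanence : ∀ i ψs p →
      ⊢ ([ act i ψs ] atom p) ⇔ (lookup ψs i ⇒ atom p)
    partial-functionality : ∀ i ψs χ →
      ⊢ ([ act i ψs ] (¬ₛ χ)) ⇔ (lookup ψs i ⇒ ¬ₛ ([ act i ψs ] χ))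
    action-knowledge : ∀ i ψs A φ →
      ⊢ ([ act i ψs ] (□ A φ)) ⇔ (lookup ψs i ⇒ AKconj i ψs A φ)
    epistemic-mix : ∀ C φ →
      ⊢ (□* C φ) ⇒ (φ ⋀ ⋀ₗ (map (λ A → □ A (□* C φ)) C))
    skip-ax   : ∀ φ → ⊢ ([ skip ] φ) ⇔ φ
    crash-ax  : ⊢ [ crash ] ⊥ₛ
    composition : ∀ π ρ φ → ⊢ ([ π ] ([ ρ ] φ)) ⇔ ([ π ⨟ ρ ] φ)
    choice    : ∀ π ρ φ → ⊢ ([ π ∪ ρ ] φ) ⇔ (([ π ] φ) ⋀ ([ ρ ] φ))
    mp        : ∀ {φ ψ} → ⊢ φ ⇒ ψ → ⊢ φ → ⊢ ψ
    nec-prog  : ∀ {φ} π → ⊢ φ → ⊢ [ π ] φ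
    nec-box   : ∀ {φ} A → ⊢ φ → ⊢ □ A φ
    nec-cbox  : ∀ {φ} C → ⊢ φ → ⊢ □* C φ
    action-rule : ∀ (α : SAct) (ψ : Sen) (C : List Agents) (χ : SAct → Sen) →
      (∀ β → α ⟶*[ C ] β → ⊢ χ β ⇒ ([ ⌜ β ⌝ ] ψ)) →
      (∀ β γ A → α ⟶*[ C ] β → A ∈ C → β ⟶[ A ] γ →
         ⊢ (χ β ⋀ Pre β) ⇒ □ A (χ γ)) →
      ⊢ χ α ⇒ ([ ⌜ α ⌝ ] (□* C ψ))

  record IsSynBisim (R : SAct → SAct → Set) : Set where
    field
      pre  : ∀ {α β} → R α β → ⊢ Pre α ⇔ Pre β
      forth : ∀ {α β} → R α β → ∀ A α′ → α ⟶[ A ] α′ → ∃[ β′ ] (β ⟶[ A ] β′ × R α′ β′)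
      back  : ∀ {α β} → R α β → ∀ A β′ → β ⟶[ A ] β′ → ∃[ α′ ] (α ⟶[ A ] α′ × R α′ β′)

  _≡ₛ_ : SAct → SAct → Set₁
  α ≡ₛ β = Σ (SAct → SAct → Set) λ R → IsSynBisim R × R α β

module Submission where

-- One proves, by induction on the size of φ and simultaneously for all syntactic bisimulations R,
-- that α R β implies ⊢ [β]φ ⇒ [α]φ; the converse of R then gives the other implication.
-- Atomic Permanence, Partial Functionality and Action-Knowledge extend from basic actions to all
-- simple actions, and together with the clauses of R they settle atoms, negation and □_A.
-- [skip], [crash], ∪ and ; are rewritten by their axioms, and [σᵢθ⃗]ψ is absorbed by appending
-- σᵢθ⃗ to both sides of R.  For □*_C the Action Rule is applied with χ_γ a disjunction of
-- [δ]□*_C χ over a finite set of R-related pairs closed under the forth clause; such a set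
-- exists because every action reachable from α differs from α only in its action indices.

open import Defs
open import Data.Nat using (ℕ; zero; suc; _+_; _<_; _≤_; s≤s)
open import Data.Nat.Properties
  using (≤-refl; ≤-reflexive; ≤-trans; m≤m+n; m≤n+m; n≤1+n; +-suc; +-assoc; +-monoˡ-≤)
open import Data.Nat.Induction using (<-wellFounded)
open import Induction.WellFounded using (Acc; acc)
open import Data.Fin using (Fin; zero; suc)
import Data.Fin as Fin
open import Data.Bool using (Bool; true; false; not; _∧_)
open import Data.Bool.Properties using (∧-conicalˡ; ∧-conicalʳ; T-≡)
open import Data.List
  using (List; []; _∷_; _++_; map; concatMap; filter; filterᵇ; allFin; length;
         cartesianProduct; cartesianProductWith)
open import Data.List.Membership.Propositional using (_∈_; _∉_; mapWith∈; find; lose)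
open import Data.List.Membership.Propositional.Properties
  using (∈-map⁺; ∈-map⁻; ∈-++⁺ˡ; ∈-++⁺ʳ; ∈-concatMap⁺; ∈-filter⁺; ∈-filter⁻; ∈-allFin;
         ∈-cartesianProduct⁺; ∈-cartesianProductWith⁺; ∈-cartesianProductWith⁻)
open import Data.List.Properties using (filter-notAll; ∷-injective; ++-assoc; ≡-dec)
open import Data.List.Relation.Unary.Any using (here; there)
open import Data.List.Relation.Unary.All using (All; []; _∷_; all?)
import Data.List.Relation.Unary.All as All
open import Data.List.Relation.Unary.All.Properties using (¬All⇒Any¬)
open import Data.Vec using (Vec; lookup; []; _∷_)
import Data.Vec as Vec
open import Data.Vec.Properties using (lookup-map)
open import Data.Product.Properties using () renaming (≡-dec to ×-≡-dec)
open import Data.Product using (_×_; ∃-syntax; _,_; proj₁; proj₂)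
open import Function using (flip; _∘_; id)
open import Function.Bundles using (Equivalence)
open import Relation.Binary.Definitions using (DecidableEquality)
open import Relation.Binary.PropositionalEquality using (_≡_; refl; sym; trans; cong; cong₂; subst)
open import Relation.Nullary using (yes; no)
open import Relation.Nullary.Decidable using (T?)

∈-mapWith∈ : ∀ {A B : Set} {xs : List A} (f : ∀ {x} → x ∈ xs → B) {x} (x∈ : x ∈ xs) → f x∈ ∈ mapWith∈ xs f
∈-mapWith∈ f (here refl) = here refl
∈-mapWith∈ f (there x∈) = there (∈-mapWith∈ (f ∘ there) x∈)

module KeyClosure {T K : Set} (_≟_ : DecidableEquality K) (key : T → K) (next : T → List T) where
  open import Data.List.Membership.DecPropositional _≟_ using (_∈?_; _∉?_)

  KeyClosed : List T → Set
  KeyClosed S = ∀ {t t′} → t ∈ S → t′ ∈ next t → ∃[ s ] (s ∈ S × key s ≡ key t′)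

  private
    ∈-map-++⁺ˡ : ∀ {k} S {S′} → k ∈ map key S → k ∈ map key (S ++ S′)
    ∈-map-++⁺ˡ S k∈ with ∈-map⁻ key k∈
    ... | s , s∈ , refl = ∈-map⁺ key (∈-++⁺ˡ s∈)

    -- Each round either finds S closed, or adds a successor whose key was not yet
    -- represented; that key leaves the list of unseen keys, which therefore shrinks.
    extend : ∀ S (unseen : List K) → (∀ t → key t ∉ map key S → key t ∈ unseen) →
             Acc _<_ (length unseen) → ∃[ S′ ] ((∀ {t} → t ∈ S → t ∈ S′) × KeyClosed S′)
    extend S unseen unseen-complete (acc smaller)
      with all? (λ t → all? (λ t′ → key t′ ∈? map key S) (next t)) S
    ... | yes closed = S , id , λ t∈ t′∈ →
      let s , s∈ , eq = ∈-map⁻ key (All.lookup (All.lookup closed t∈) t′∈) in s , s∈ , sym eq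
    ... | no ¬closed =
      let t , t∈S , ¬all = find (¬All⇒Any¬ (λ t → all? (λ t′ → key t′ ∈? map key S) (next t)) S ¬closed)
          t′ , t′∈ , new = find (¬All⇒Any¬ (λ t′ → key t′ ∈? map key S) (next t) ¬all)
          S′ = S ++ concatMap next S
          seen′ : key t′ ∈ map key S′
          seen′ = ∈-map⁺ key (∈-++⁺ʳ S (∈-concatMap⁺ next (lose t∈S t′∈)))
          unseen′ = filter (_∉? map key S′) unseen
          shorter : length unseen′ < length unseen
          shorter = filter-notAll (_∉? map key S′) unseen (lose (unseen-complete t′ new) (λ ∉ → ∉ seen′))
          unseen′-complete : ∀ u → key u ∉ map key S′ → key u ∈ unseen′
          unseen′-complete u ∉S′ =
            ∈-filter⁺ (_∉? map key S′) (unseen-complete u (∉S′ ∘ ∈-map-++⁺ˡ S)) ∉S′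
          S″ , S′⊆S″ , closed = extend S′ unseen′ unseen′-complete (smaller shorter)
      in S″ , S′⊆S″ ∘ ∈-++⁺ˡ , closed

  keyClosure : (keys : List K) → (∀ t → key t ∈ keys) → ∀ t₀ → ∃[ S ] (t₀ ∈ S × KeyClosed S)
  keyClosure keys key∈ t₀ with extend (t₀ ∷ []) keys (λ t _ → key∈ t) (<-wellFounded (length keys))
  ... | S , ⊆S , closed = S , ⊆S (here refl) , closed

module Invariance (AtSen Agents : Set) (Sig : Signature Agents) where
  open Signature Sig renaming (size to n)
  open L₁ AtSen Agents Sig

  infix 9 ¬ᶠ_
  infixr 8 _∧ᶠ_
  infixr 7 _⇒ᶠ_
  infix 6 _⇔ᶠ_

  data Formula (k : ℕ) : Set where
    var  : Fin k → Formula k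
    ⊤ᶠ   : Formula k
    ¬ᶠ_  : Formula k → Formula k
    _∧ᶠ_ : Formula k → Formula k → Formula k

  _⇒ᶠ_ : ∀ {k} → Formula k → Formula k → Formula k
  f ⇒ᶠ g = ¬ᶠ (f ∧ᶠ ¬ᶠ g)

  _⇔ᶠ_ : ∀ {k} → Formula k → Formula k → Formula k
  f ⇔ᶠ g = (f ⇒ᶠ g) ∧ᶠ (g ⇒ᶠ f)

  ⟦_⟧ : ∀ {k} → Formula k → Vec Sen k → Sen
  ⟦ var i ⟧  ρ = lookup ρ i
  ⟦ ⊤ᶠ ⟧     ρ = ⊤ₛ
  ⟦ ¬ᶠ f ⟧   ρ = ¬ₛ ⟦ f ⟧ ρ
  ⟦ f ∧ᶠ g ⟧ ρ = ⟦ f ⟧ ρ ⋀ ⟦ g ⟧ ρ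

  truth : ∀ {k} → Formula k → Vec Bool k → Bool
  truth (var i)  b = lookup b i
  truth ⊤ᶠ       b = true
  truth (¬ᶠ f)   b = not (truth f b)
  truth (f ∧ᶠ g) b = truth f b ∧ truth g b

  everywhere : ∀ k → (Vec Bool k → Bool) → Bool
  everywhere zero    g = g []
  everywhere (suc k) g = everywhere k (g ∘ (true ∷_)) ∧ everywhere k (g ∘ (false ∷_))

  everywhere-sound : ∀ k g → everywhere k g ≡ true → ∀ b → g b ≡ true
  everywhere-sound zero    g h [] = h
  everywhere-sound (suc k) g h (true ∷ b)  = everywhere-sound k _ (∧-conicalˡ _ _ h) b
  everywhere-sound (suc k) g h (false ∷ b) = everywhere-sound k _ (∧-conicalʳ _ _ h) b

  eval-⟦⟧ : ∀ {k} v (f : Formula k) ρ → eval v (⟦ f ⟧ ρ) ≡ truth f (Vec.map (eval v) ρ)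
  eval-⟦⟧ v (var i)  ρ = sym (lookup-map i (eval v) ρ)
  eval-⟦⟧ v ⊤ᶠ       ρ = refl
  eval-⟦⟧ v (¬ᶠ f)   ρ = cong not (eval-⟦⟧ v f ρ)
  eval-⟦⟧ v (f ∧ᶠ g) ρ = cong₂ _∧_ (eval-⟦⟧ v f ρ) (eval-⟦⟧ v g ρ)

  tautology-instance : ∀ {k} (f : Formula k) ρ → everywhere k (truth f) ≡ true → ⊢ ⟦ f ⟧ ρ
  tautology-instance {k} f ρ h =
    taut λ v → trans (eval-⟦⟧ v f ρ) (everywhere-sound k (truth f) h (Vec.map (eval v) ρ))

  _⇒*_ : ∀ {k} → List (Formula k) → Formula k → Formula k
  []       ⇒* c = c
  (h ∷ hs) ⇒* c = h ⇒ᶠ (hs ⇒* c)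

  modus-ponens* : ∀ {k} hs (c : Formula k) ρ → ⊢ ⟦ hs ⇒* c ⟧ ρ → All (λ h → ⊢ ⟦ h ⟧ ρ) hs → ⊢ ⟦ c ⟧ ρ
  modus-ponens* []       c ρ ⊢c  []         = ⊢c
  modus-ponens* (h ∷ hs) c ρ ⊢hc (⊢h ∷ ⊢hs) = modus-ponens* hs c ρ (mp ⊢hc ⊢h) ⊢hs

  -- Propositional reasoning: the premises hs entail c in every Boolean valuation (checked
  -- by evaluation, so the fourth argument is refl), hence any instance ρ of the premises
  -- yields the instance of c.
  by-tautology : ∀ {k} hs (c : Formula k) ρ → everywhere k (truth (hs ⇒* c)) ≡ true →
                 All (λ h → ⊢ ⟦ h ⟧ ρ) hs → ⊢ ⟦ c ⟧ ρ
  by-tautology hs c ρ valid = modus-ponens* hs c ρ (tautology-instance (hs ⇒* c) ρ valid)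

  v₀ : ∀ {k} → Formula (1 + k)
  v₀ = var zero
  v₁ : ∀ {k} → Formula (2 + k)
  v₁ = var (suc zero)
  v₂ : ∀ {k} → Formula (3 + k)
  v₂ = var (suc (suc zero))
  v₃ : ∀ {k} → Formula (4 + k)
  v₃ = var (suc (suc (suc zero)))
  v₄ : ∀ {k} → Formula (5 + k)
  v₄ = var (suc (suc (suc (suc zero))))
  v₅ : ∀ {k} → Formula (6 + k)
  v₅ = var (suc (suc (suc (suc (suc zero)))))
  v₆ : ∀ {k} → Formula (7 + k)
  v₆ = var (suc (suc (suc (suc (suc (suc zero))))))
  v₇ : ∀ {k} → Formula (8 + k)
  v₇ = var (suc (suc (suc (suc (suc (suc (suc zero)))))))

  ⇒-trans : ∀ {φ ψ χ} → ⊢ φ ⇒ ψ → ⊢ ψ ⇒ χ → ⊢ φ ⇒ χ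
  ⇒-trans {φ} {ψ} {χ} p q =
    by-tautology (v₀ ⇒ᶠ v₁ ∷ v₁ ⇒ᶠ v₂ ∷ []) (v₀ ⇒ᶠ v₂) (φ ∷ ψ ∷ χ ∷ []) refl (p ∷ q ∷ [])

  ⇒-const : ∀ {φ ψ} → ⊢ ψ → ⊢ φ ⇒ ψ
  ⇒-const {φ} {ψ} p = by-tautology (v₁ ∷ []) (v₀ ⇒ᶠ v₁) (φ ∷ ψ ∷ []) refl (p ∷ [])

  ⇔-to : ∀ {φ ψ} → ⊢ φ ⇔ ψ → ⊢ φ ⇒ ψ
  ⇔-to {φ} {ψ} p = by-tautology (v₀ ⇔ᶠ v₁ ∷ []) (v₀ ⇒ᶠ v₁) (φ ∷ ψ ∷ []) refl (p ∷ [])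

  ⇔-from : ∀ {φ ψ} → ⊢ φ ⇔ ψ → ⊢ ψ ⇒ φ
  ⇔-from {φ} {ψ} p = by-tautology (v₀ ⇔ᶠ v₁ ∷ []) (v₁ ⇒ᶠ v₀) (φ ∷ ψ ∷ []) refl (p ∷ [])

  ⇔-intro : ∀ {φ ψ} → ⊢ φ ⇒ ψ → ⊢ ψ ⇒ φ → ⊢ φ ⇔ ψ
  ⇔-intro {φ} {ψ} p q =
    by-tautology (v₀ ⇒ᶠ v₁ ∷ v₁ ⇒ᶠ v₀ ∷ []) (v₀ ⇔ᶠ v₁) (φ ∷ ψ ∷ []) refl (p ∷ q ∷ [])

  ⇔-sym : ∀ {φ ψ} → ⊢ φ ⇔ ψ → ⊢ ψ ⇔ φ
  ⇔-sym p = ⇔-intro (⇔-from p) (⇔-to p)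

  []-mono : ∀ {φ ψ} π → ⊢ φ ⇒ ψ → ⊢ ([ π ] φ) ⇒ ([ π ] ψ)
  []-mono {φ} {ψ} π h = mp (K-prog π φ ψ) (nec-prog π h)

  □-mono : ∀ {φ ψ} A → ⊢ φ ⇒ ψ → ⊢ (□ A φ) ⇒ (□ A ψ)
  □-mono {φ} {ψ} A h = mp (K-box A φ ψ) (nec-box A h)

  []-cong : ∀ {φ ψ} π → ⊢ φ ⇔ ψ → ⊢ ([ π ] φ) ⇔ ([ π ] ψ)
  []-cong π h = ⇔-intro ([]-mono π (⇔-to h)) ([]-mono π (⇔-from h))

  []-⊤ : ∀ π → ⊢ [ π ] ⊤ₛ
  []-⊤ π = nec-prog π (taut λ v → refl)

  []-⋀ : ∀ π φ ψ → ⊢ (([ π ] φ) ⋀ ([ π ] ψ)) ⇒ ([ π ] (φ ⋀ ψ))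
  []-⋀ π φ ψ = by-tautology (v₀ ⇒ᶠ v₂ ∷ v₂ ⇒ᶠ v₁ ⇒ᶠ v₃ ∷ []) (v₀ ∧ᶠ v₁ ⇒ᶠ v₃)
    ([ π ] φ ∷ [ π ] ψ ∷ [ π ] (ψ ⇒ (φ ⋀ ψ)) ∷ [ π ] (φ ⋀ ψ) ∷ []) refl
    ([]-mono π (by-tautology [] (v₀ ⇒ᶠ v₁ ⇒ᶠ v₀ ∧ᶠ v₁) (φ ∷ ψ ∷ []) refl []) ∷ K-prog π ψ (φ ⋀ ψ) ∷ [])

  [crash] : ∀ φ → ⊢ [ crash ] φ
  [crash] φ = mp ([]-mono crash (by-tautology [] (¬ᶠ ⊤ᶠ ⇒ᶠ v₀) (φ ∷ []) refl [])) crash-ax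

  ⋀ₗ-elim : ∀ {φ φs} → φ ∈ φs → ⊢ ⋀ₗ φs ⇒ φ
  ⋀ₗ-elim {φs = φ ∷ φs} (here refl) = by-tautology [] (v₀ ∧ᶠ v₁ ⇒ᶠ v₀) (φ ∷ ⋀ₗ φs ∷ []) refl []
  ⋀ₗ-elim {φs = ψ ∷ φs} (there φ∈) =
    ⇒-trans (by-tautology [] (v₀ ∧ᶠ v₁ ⇒ᶠ v₁) (ψ ∷ ⋀ₗ φs ∷ []) refl []) (⋀ₗ-elim φ∈)

  ⋀ₗ-intro : ∀ {χ} φs → (∀ {φ} → φ ∈ φs → ⊢ χ ⇒ φ) → ⊢ χ ⇒ ⋀ₗ φs
  ⋀ₗ-intro []       h = ⇒-const (taut λ v → refl)
  ⋀ₗ-intro {χ} (φ ∷ φs) h =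
    by-tautology (v₀ ⇒ᶠ v₁ ∷ v₀ ⇒ᶠ v₂ ∷ []) (v₀ ⇒ᶠ v₁ ∧ᶠ v₂) (χ ∷ φ ∷ ⋀ₗ φs ∷ []) refl
      (h (here refl) ∷ ⋀ₗ-intro φs (h ∘ there) ∷ [])

  []-⋀ₗ-intro : ∀ {χ} π φs → (∀ {φ} → φ ∈ φs → ⊢ χ ⇒ [ π ] φ) → ⊢ χ ⇒ [ π ] ⋀ₗ φs
  []-⋀ₗ-intro π []       h = ⇒-const ([]-⊤ π)
  []-⋀ₗ-intro {χ} π (φ ∷ φs) h =
    by-tautology (v₀ ⇒ᶠ v₁ ∷ v₀ ⇒ᶠ v₂ ∷ v₁ ∧ᶠ v₂ ⇒ᶠ v₃ ∷ []) (v₀ ⇒ᶠ v₃)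
      (χ ∷ [ π ] φ ∷ [ π ] ⋀ₗ φs ∷ [ π ] ⋀ₗ (φ ∷ φs) ∷ []) refl
      (h (here refl) ∷ []-⋀ₗ-intro π φs (h ∘ there) ∷ []-⋀ π φ (⋀ₗ φs) ∷ [])

  ⋁ₗ : List Sen → Sen
  ⋁ₗ []       = ⊥ₛ
  ⋁ₗ (φ ∷ φs) = ¬ₛ (¬ₛ φ ⋀ ¬ₛ ⋁ₗ φs)

  ⋁ₗ-intro : ∀ {φ φs} → φ ∈ φs → ⊢ φ ⇒ ⋁ₗ φs
  ⋁ₗ-intro {φs = φ ∷ φs} (here refl) =
    by-tautology [] (v₀ ⇒ᶠ ¬ᶠ (¬ᶠ v₀ ∧ᶠ ¬ᶠ v₁)) (φ ∷ ⋁ₗ φs ∷ []) refl []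
  ⋁ₗ-intro {φs = ψ ∷ φs} (there φ∈) =
    ⇒-trans (⋁ₗ-intro φ∈) (by-tautology [] (v₁ ⇒ᶠ ¬ᶠ (¬ᶠ v₀ ∧ᶠ ¬ᶠ v₁)) (ψ ∷ ⋁ₗ φs ∷ []) refl [])

  ⋁ₗ-elim : ∀ {χ} φs → (∀ {φ} → φ ∈ φs → ⊢ φ ⇒ χ) → ⊢ ⋁ₗ φs ⇒ χ
  ⋁ₗ-elim {χ} []       h = by-tautology [] (¬ᶠ ⊤ᶠ ⇒ᶠ v₀) (χ ∷ []) refl []
  ⋁ₗ-elim {χ} (φ ∷ φs) h =
    by-tautology (v₀ ⇒ᶠ v₂ ∷ v₁ ⇒ᶠ v₂ ∷ []) (¬ᶠ (¬ᶠ v₀ ∧ᶠ ¬ᶠ v₁) ⇒ᶠ v₂) (φ ∷ ⋁ₗ φs ∷ χ ∷ []) refl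
      (h (here refl) ∷ ⋁ₗ-elim φs (h ∘ there) ∷ [])

  PartiallyFunctional : Prog → Sen → Set
  PartiallyFunctional π P = ∀ χ → ⊢ ([ π ] (¬ₛ χ)) ⇔ (P ⇒ ¬ₛ ([ π ] χ))

  module _ {π P} (functional : PartiallyFunctional π P) where

    []-⇒ : ∀ ψ χ → ⊢ ([ π ] (ψ ⇒ χ)) ⇔ ((⟨ π ⟩ ψ) ⇒ [ π ] χ)
    []-⇒ ψ χ = by-tautology
      (v₀ ⇒ᶠ v₁ ⇒ᶠ v₂ ∷ v₃ ⇔ᶠ (v₄ ⇒ᶠ ¬ᶠ v₁) ∷ v₃ ⇒ᶠ v₀ ∷ v₂ ⇒ᶠ v₀ ∷ [])
      (v₀ ⇔ᶠ (¬ᶠ v₃ ⇒ᶠ v₂))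
      ([ π ] (ψ ⇒ χ) ∷ [ π ] ψ ∷ [ π ] χ ∷ [ π ] (¬ₛ ψ) ∷ P ∷ []) refl
      (K-prog π ψ χ ∷ functional ψ
       ∷ []-mono π (by-tautology [] (¬ᶠ v₀ ⇒ᶠ v₀ ⇒ᶠ v₁) (ψ ∷ χ ∷ []) refl [])
       ∷ []-mono π (by-tautology [] (v₁ ⇒ᶠ v₀ ⇒ᶠ v₁) (ψ ∷ χ ∷ []) refl []) ∷ [])

    ⟨⟩⇒pre : ∀ ψ → ⊢ (⟨ π ⟩ ψ) ⇒ P
    ⟨⟩⇒pre ψ = by-tautology (v₀ ⇔ᶠ (v₁ ⇒ᶠ ¬ᶠ v₂) ∷ []) (¬ᶠ v₀ ⇒ᶠ v₁)
      ([ π ] (¬ₛ ψ) ∷ P ∷ [ π ] ψ ∷ []) refl (functional ψ ∷ [])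

    ⟨⟩⇒[] : ∀ ψ → ⊢ (⟨ π ⟩ ψ) ⇒ [ π ] ψ
    ⟨⟩⇒[] ψ = by-tautology (v₀ ⇔ᶠ (v₁ ⇒ᶠ ¬ᶠ v₂) ∷ []) (¬ᶠ v₀ ⇒ᶠ v₂)
      ([ π ] (¬ₛ ψ) ∷ P ∷ [ π ] ψ ∷ []) refl (functional ψ ∷ [])

  simple-partial-functionality : ∀ α → PartiallyFunctional ⌜ α ⌝ (Pre α)
  simple-partial-functionality skip χ = by-tautology (v₀ ⇔ᶠ ¬ᶠ v₁ ∷ v₂ ⇔ᶠ v₁ ∷ []) (v₀ ⇔ᶠ (⊤ᶠ ⇒ᶠ ¬ᶠ v₂))
    ([ skip ] (¬ₛ χ) ∷ χ ∷ [ skip ] χ ∷ []) refl (skip-ax (¬ₛ χ) ∷ skip-ax χ ∷ [])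
  simple-partial-functionality crash χ = by-tautology (v₀ ∷ []) (v₀ ⇔ᶠ (¬ᶠ ⊤ᶠ ⇒ᶠ ¬ᶠ v₁))
    ([ crash ] (¬ₛ χ) ∷ [ crash ] χ ∷ []) refl ([crash] (¬ₛ χ) ∷ [])
  simple-partial-functionality (act i ψs) χ = partial-functionality i ψs χ
  simple-partial-functionality (α ⨟ β) χ = by-tautology
    (v₁ ⇔ᶠ v₀ ∷ v₁ ⇔ᶠ v₂ ∷ v₂ ⇔ᶠ (¬ᶠ v₃ ⇒ᶠ v₄) ∷ v₄ ⇔ᶠ (v₅ ⇒ᶠ ¬ᶠ v₆) ∷ ¬ᶠ v₃ ⇒ᶠ v₅ ∷ v₆ ⇔ᶠ v₇ ∷ [])
    (v₀ ⇔ᶠ (¬ᶠ v₃ ⇒ᶠ ¬ᶠ v₇))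
    ([ π ⨟ ρ ] (¬ₛ χ) ∷ [ π ] ([ ρ ] (¬ₛ χ)) ∷ [ π ] (Pre β ⇒ ¬ₛ ([ ρ ] χ)) ∷ [ π ] (¬ₛ Pre β)
      ∷ [ π ] (¬ₛ ([ ρ ] χ)) ∷ Pre α ∷ [ π ] ([ ρ ] χ) ∷ [ π ⨟ ρ ] χ ∷ []) refl
    (composition π ρ (¬ₛ χ) ∷ []-cong π (simple-partial-functionality β χ)
     ∷ []-⇒ (simple-partial-functionality α) (Pre β) (¬ₛ ([ ρ ] χ))
     ∷ simple-partial-functionality α ([ ρ ] χ) ∷ ⟨⟩⇒pre (simple-partial-functionality α) (Pre β)
     ∷ composition π ρ χ ∷ [])
    where π = ⌜ α ⌝
          ρ = ⌜ β ⌝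

  simple-atomic-permanence : ∀ α p → ⊢ ([ ⌜ α ⌝ ] atom p) ⇔ (Pre α ⇒ atom p)
  simple-atomic-permanence skip p = by-tautology (v₀ ⇔ᶠ v₁ ∷ []) (v₀ ⇔ᶠ (⊤ᶠ ⇒ᶠ v₁))
    ([ skip ] atom p ∷ atom p ∷ []) refl (skip-ax (atom p) ∷ [])
  simple-atomic-permanence crash p = by-tautology (v₀ ∷ []) (v₀ ⇔ᶠ (¬ᶠ ⊤ᶠ ⇒ᶠ v₁))
    ([ crash ] atom p ∷ atom p ∷ []) refl ([crash] (atom p) ∷ [])
  simple-atomic-permanence (act i ψs) p = atomic-permanence i ψs p
  simple-atomic-permanence (α ⨟ β) p = by-tautology
    (v₁ ⇔ᶠ v₀ ∷ v₁ ⇔ᶠ v₂ ∷ v₂ ⇔ᶠ (¬ᶠ v₃ ⇒ᶠ v₄) ∷ v₄ ⇔ᶠ (v₅ ⇒ᶠ v₆) ∷ ¬ᶠ v₃ ⇒ᶠ v₅ ∷ [])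
    (v₀ ⇔ᶠ (¬ᶠ v₃ ⇒ᶠ v₆))
    ([ π ⨟ ρ ] atom p ∷ [ π ] ([ ρ ] atom p) ∷ [ π ] (Pre β ⇒ atom p) ∷ [ π ] (¬ₛ Pre β)
      ∷ [ π ] atom p ∷ Pre α ∷ atom p ∷ []) refl
    (composition π ρ (atom p) ∷ []-cong π (simple-atomic-permanence β p)
     ∷ []-⇒ (simple-partial-functionality α) (Pre β) (atom p)
     ∷ simple-atomic-permanence α p ∷ ⟨⟩⇒pre (simple-partial-functionality α) (Pre β) ∷ [])
    where π = ⌜ α ⌝
          ρ = ⌜ β ⌝

  successors : Agents → SAct → List SAct
  successors A skip       = skip ∷ []
  successors A crash      = []
  successors A (act i ψs) = map (λ j → act j ψs) (filterᵇ (arr A i) (allFin n))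
  successors A (α ⨟ β)    = cartesianProductWith _⨟_ (successors A α) (successors A β)

  successors-sound : ∀ {A γ γ′} → γ′ ∈ successors A γ → γ ⟶[ A ] γ′
  successors-sound {γ = skip} (here refl) = skip→
  successors-sound {A} {act i ψs} γ′∈ with ∈-map⁻ (λ j → act j ψs) γ′∈
  ... | j , j∈ , refl = act→ (Equivalence.to T-≡ (proj₂ (∈-filter⁻ (T? ∘ arr A i) {xs = allFin n} j∈)))
  successors-sound {A} {α ⨟ β} γ′∈
    with ∈-cartesianProductWith⁻ _⨟_ (successors A α) (successors A β) γ′∈
  ... | α′ , β′ , α′∈ , β′∈ , refl = seq→ (successors-sound α′∈) (successors-sound β′∈)

  successors-complete : ∀ {A γ γ′} → γ ⟶[ A ] γ′ → γ′ ∈ successors A γ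
  successors-complete skip→ = here refl
  successors-complete {A} (act→ {i = i} {j} {ψs} e) =
    ∈-map⁺ (λ j → act j ψs) (∈-filter⁺ (T? ∘ arr A i) (∈-allFin j) (Equivalence.from T-≡ e))
  successors-complete (seq→ p q) =
    ∈-cartesianProductWith⁺ _⨟_ (successors-complete p) (successors-complete q)

  simple-action-knowledge⇒ : ∀ {α α′ A} → α ⟶[ A ] α′ → ∀ φ →
                             ⊢ (([ ⌜ α ⌝ ] □ A φ) ⋀ Pre α) ⇒ □ A ([ ⌜ α′ ⌝ ] φ)
  simple-action-knowledge⇒ {A = A} skip→ φ = by-tautology (v₀ ⇔ᶠ v₁ ∷ v₁ ⇒ᶠ v₂ ∷ []) (v₀ ∧ᶠ ⊤ᶠ ⇒ᶠ v₂)
    ([ skip ] □ A φ ∷ □ A φ ∷ □ A ([ skip ] φ) ∷ []) refl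
    (skip-ax (□ A φ) ∷ □-mono A (⇔-from (skip-ax φ)) ∷ [])
  simple-action-knowledge⇒ {A = A} (act→ {i = i} {j} {ψs} e) φ =
    by-tautology (v₀ ⇔ᶠ (v₁ ⇒ᶠ v₂) ∷ v₂ ⇒ᶠ v₃ ∷ []) (v₀ ∧ᶠ v₁ ⇒ᶠ v₃)
      ([ act i ψs ] □ A φ ∷ lookup ψs i ∷ AKconj i ψs A φ ∷ □ A ([ act j ψs ] φ) ∷ []) refl
      (action-knowledge i ψs A φ
       ∷ ⋀ₗ-elim (∈-map⁺ (λ k → □ A ([ act k ψs ] φ))
                   (∈-filter⁺ (T? ∘ arr A i) (∈-allFin j) (Equivalence.from T-≡ e))) ∷ [])
  simple-action-knowledge⇒ {α ⨟ β} {α′ ⨟ β′} {A} (seq→ p q) φ = ⇒-trans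
    (by-tautology
      (v₁ ⇔ᶠ v₀ ∷ v₂ ⇒ᶠ v₃ ∷ v₁ ∧ᶠ v₄ ⇒ᶠ v₂ ∷ ¬ᶠ v₅ ⇒ᶠ v₆ ∷ ¬ᶠ v₅ ⇒ᶠ v₄ ∷ v₃ ∧ᶠ v₆ ⇒ᶠ v₇ ∷ [])
      (v₀ ∧ᶠ ¬ᶠ v₅ ⇒ᶠ v₇)
      ([ π ⨟ ρ ] □ A φ ∷ [ π ] ([ ρ ] □ A φ) ∷ [ π ] (([ ρ ] □ A φ) ⋀ Pre β) ∷ [ π ] □ A ([ ρ′ ] φ)
        ∷ [ π ] Pre β ∷ [ π ] (¬ₛ Pre β) ∷ Pre α ∷ □ A ([ π′ ] ([ ρ′ ] φ)) ∷ []) refl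
      (composition π ρ (□ A φ) ∷ []-mono π (simple-action-knowledge⇒ q φ) ∷ []-⋀ π _ _
       ∷ ⟨⟩⇒pre (simple-partial-functionality α) (Pre β) ∷ ⟨⟩⇒[] (simple-partial-functionality α) (Pre β)
       ∷ simple-action-knowledge⇒ p ([ ρ′ ] φ) ∷ []))
    (□-mono A (⇔-to (composition π′ ρ′ φ)))
    where π = ⌜ α ⌝
          ρ = ⌜ β ⌝
          π′ = ⌜ α′ ⌝
          ρ′ = ⌜ β′ ⌝

  simple-action-knowledge⇐ : ∀ α A φ {χ} →
                             (∀ {α′} → α ⟶[ A ] α′ → ⊢ (χ ⋀ Pre α) ⇒ □ A ([ ⌜ α′ ⌝ ] φ)) →
                             ⊢ χ ⇒ [ ⌜ α ⌝ ] □ A φ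
  simple-action-knowledge⇐ skip A φ {χ} H =
    by-tautology (v₀ ∧ᶠ ⊤ᶠ ⇒ᶠ v₁ ∷ v₁ ⇒ᶠ v₂ ∷ v₃ ⇔ᶠ v₂ ∷ []) (v₀ ⇒ᶠ v₃)
      (χ ∷ □ A ([ skip ] φ) ∷ □ A φ ∷ [ skip ] □ A φ ∷ []) refl
      (H skip→ ∷ □-mono A (⇔-to (skip-ax φ)) ∷ skip-ax (□ A φ) ∷ [])
  simple-action-knowledge⇐ crash A φ H = ⇒-const ([crash] (□ A φ))
  simple-action-knowledge⇐ (act i ψs) A φ {χ} H =
    by-tautology (v₀ ∧ᶠ v₁ ⇒ᶠ v₂ ∷ v₃ ⇔ᶠ (v₁ ⇒ᶠ v₂) ∷ []) (v₀ ⇒ᶠ v₃)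
      (χ ∷ lookup ψs i ∷ AKconj i ψs A φ ∷ [ act i ψs ] □ A φ ∷ []) refl
      (⋀ₗ-intro _ (λ φ′∈ → case-target (∈-map⁻ (λ j → □ A ([ act j ψs ] φ)) φ′∈))
       ∷ action-knowledge i ψs A φ ∷ [])
    where
      case-target : ∀ {φ′} → ∃[ j ] (j ∈ filterᵇ (arr A i) (allFin n) × φ′ ≡ □ A ([ act j ψs ] φ)) →
                    ⊢ (χ ⋀ lookup ψs i) ⇒ φ′
      case-target (j , j∈ , refl) = H (successors-sound (∈-map⁺ (λ k → act k ψs) j∈))
  simple-action-knowledge⇐ (α ⨟ β) A φ {χ} H =
    by-tautology (v₃ ⇒ᶠ v₄ ∷ v₄ ⇔ᶠ v₅ ∷ v₃ ⇔ᶠ (v₁ ⇒ᶠ v₂) ∷ v₀ ∧ᶠ v₁ ⇒ᶠ v₂ ∷ []) (v₀ ⇒ᶠ v₅)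
      (χ ∷ ⟨ π ⟩ Pre β ∷ [ π ] Y ∷ [ π ] (Pre β ⇒ Y) ∷ [ π ] ([ ρ ] □ A φ) ∷ [ π ⨟ ρ ] □ A φ ∷ []) refl
      ([]-mono π β-step ∷ composition π ρ (□ A φ)
       ∷ []-⇒ (simple-partial-functionality α) (Pre β) Y ∷ α-step ∷ [])
    where
      π = ⌜ α ⌝
      ρ = ⌜ β ⌝
      Y : Sen
      Y = ⋀ₗ (map (λ β′ → □ A ([ ⌜ β′ ⌝ ] φ)) (successors A β))
      β-step : ⊢ (Pre β ⇒ Y) ⇒ [ ρ ] □ A φ
      β-step = simple-action-knowledge⇐ β A φ λ q →
        ⇒-trans (by-tautology [] ((v₀ ⇒ᶠ v₁) ∧ᶠ v₀ ⇒ᶠ v₁) (Pre β ∷ Y ∷ []) refl [])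
                (⋀ₗ-elim (∈-map⁺ (λ β′ → □ A ([ ⌜ β′ ⌝ ] φ)) (successors-complete q)))
      α-step : ⊢ (χ ⋀ ⟨ π ⟩ Pre β) ⇒ [ π ] Y
      α-step = []-⋀ₗ-intro π _ λ φ′∈ → case-successor (∈-map⁻ (λ β′ → □ A ([ ⌜ β′ ⌝ ] φ)) φ′∈)
        where
          case-successor : ∀ {φ′} → ∃[ β′ ] (β′ ∈ successors A β × φ′ ≡ □ A ([ ⌜ β′ ⌝ ] φ)) →
                           ⊢ (χ ⋀ ⟨ π ⟩ Pre β) ⇒ [ π ] φ′
          case-successor (β′ , β′∈ , refl) = simple-action-knowledge⇐ α A ([ ⌜ β′ ⌝ ] φ) λ p →
            ⇒-trans (by-tautology [] ((v₀ ∧ᶠ v₁) ∧ᶠ v₂ ⇒ᶠ v₀ ∧ᶠ v₁) (χ ∷ ⟨ π ⟩ Pre β ∷ Pre α ∷ []) refl [])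
              (⇒-trans (H (seq→ p (successors-sound β′∈)))
                       (□-mono A (⇔-from (composition ⌜ _ ⌝ ⌜ β′ ⌝ φ))))

  □*-elim : ∀ C χ → ⊢ (□* C χ) ⇒ χ
  □*-elim C χ = ⇒-trans (epistemic-mix C χ)
    (by-tautology [] (v₀ ∧ᶠ v₁ ⇒ᶠ v₀) (χ ∷ ⋀ₗ (map (λ A → □ A (□* C χ)) C) ∷ []) refl [])

  □*-unfold : ∀ {A C} χ → A ∈ C → ⊢ (□* C χ) ⇒ □ A (□* C χ)
  □*-unfold {C = C} χ A∈C = ⇒-trans (epistemic-mix C χ)
    (⇒-trans (by-tautology [] (v₀ ∧ᶠ v₁ ⇒ᶠ v₁) (χ ∷ ⋀ₗ (map (λ A → □ A (□* C χ)) C) ∷ []) refl [])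
             (⋀ₗ-elim (∈-map⁺ (λ A → □ A (□* C χ)) A∈C)))

  data SameShape : SAct → SAct → Set where
    skip  : SameShape skip skip
    crash : SameShape crash crash
    act   : ∀ {i j ψs} → SameShape (act i ψs) (act j ψs)
    _⨟_   : ∀ {α α′ β β′} → SameShape α α′ → SameShape β β′ → SameShape (α ⨟ β) (α′ ⨟ β′)

  SameShape-refl : ∀ α → SameShape α α
  SameShape-refl skip       = skip
  SameShape-refl crash      = crash
  SameShape-refl (act i ψs) = act
  SameShape-refl (α ⨟ β)    = SameShape-refl α ⨟ SameShape-refl β

  SameShape-sym : ∀ {α β} → SameShape α β → SameShape β α
  SameShape-sym skip    = skip
  SameShape-sym crash   = crash
  SameShape-sym act     = act
  SameShape-sym (s ⨟ t) = SameShape-sym s ⨟ SameShape-sym t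

  SameShape-trans : ∀ {α β γ} → SameShape α β → SameShape β γ → SameShape α γ
  SameShape-trans skip    skip      = skip
  SameShape-trans crash   crash     = crash
  SameShape-trans act     act       = act
  SameShape-trans (s ⨟ t) (s′ ⨟ t′) = SameShape-trans s s′ ⨟ SameShape-trans t t′

  ⟶⇒SameShape : ∀ {α α′ A} → α ⟶[ A ] α′ → SameShape α α′
  ⟶⇒SameShape skip→     = skip
  ⟶⇒SameShape (act→ _)  = act
  ⟶⇒SameShape (seq→ p q) = ⟶⇒SameShape p ⨟ ⟶⇒SameShape q

  ⟶*⇒SameShape : ∀ {α α′ C} → α ⟶*[ C ] α′ → SameShape α α′
  ⟶*⇒SameShape {α} refl*   = SameShape-refl α
  ⟶*⇒SameShape (step* _ p r) = SameShape-trans (⟶⇒SameShape p) (⟶*⇒SameShape r)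

  indices : SAct → List (Fin n)
  indices skip      = []
  indices crash     = []
  indices (act i _) = i ∷ []
  indices (α ⨟ β)   = indices α ++ indices β

  indices-cancel : ∀ {α α′} → SameShape α α′ → ∀ {xs ys} →
                   indices α ++ xs ≡ indices α′ ++ ys → α ≡ α′ × xs ≡ ys
  indices-cancel skip  eq = refl , eq
  indices-cancel crash eq = refl , eq
  indices-cancel act   eq with ∷-injective eq
  ... | refl , eq′ = refl , eq′
  indices-cancel (_⨟_ {α} {α′} {β} {β′} s t) {xs} {ys} eq
    with indices-cancel s (trans (sym (++-assoc (indices α) (indices β) xs))
                            (trans eq (++-assoc (indices α′) (indices β′) ys)))
  ... | refl , eq′ with indices-cancel t eq′
  ... | refl , eq″ = refl , eq″

  indices-injective : ∀ {α α′} → SameShape α α′ → indices α ≡ indices α′ → α ≡ α′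
  indices-injective s eq = proj₁ (indices-cancel s (cong (_++ []) eq))

  variants : SAct → List SAct
  variants skip       = skip ∷ []
  variants crash      = crash ∷ []
  variants (act i ψs) = map (λ j → act j ψs) (allFin n)
  variants (α ⨟ β)    = cartesianProductWith _⨟_ (variants α) (variants β)

  variants-complete : ∀ {α α′} → SameShape α α′ → α′ ∈ variants α
  variants-complete skip  = here refl
  variants-complete crash = here refl
  variants-complete (act {j = j} {ψs}) = ∈-map⁺ (λ k → act k ψs) (∈-allFin j)
  variants-complete (s ⨟ t) = ∈-cartesianProductWith⁺ _⨟_ (variants-complete s) (variants-complete t)

  converse : ∀ {R} → IsSynBisim R → IsSynBisim (flip R)
  converse bisim = record { pre = λ r → ⇔-sym (pre r) ; forth = back ; back = forth }
    where open IsSynBisim bisim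

  Transfers : Sen → Set₁
  Transfers φ = ∀ {R} → IsSynBisim R → ∀ {α β} → R α β → ⊢ ([ ⌜ β ⌝ ] φ) ⇒ ([ ⌜ α ⌝ ] φ)

  transfers-theorem : ∀ {φ} → ⊢ φ → Transfers φ
  transfers-theorem ⊢φ _ {α} _ = ⇒-const (nec-prog ⌜ α ⌝ ⊢φ)

  transfers-⇔ : ∀ {φ ψ} → ⊢ φ ⇔ ψ → Transfers ψ → Transfers φ
  transfers-⇔ φ⇔ψ transfer bisim {α} {β} r =
    ⇒-trans ([]-mono ⌜ β ⌝ (⇔-to φ⇔ψ)) (⇒-trans (transfer bisim r) ([]-mono ⌜ α ⌝ (⇔-from φ⇔ψ)))

  transfers-atom : ∀ p → Transfers (atom p)
  transfers-atom p bisim {α} {β} r =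
    by-tautology (v₀ ⇔ᶠ (v₂ ⇒ᶠ v₄) ∷ v₁ ⇔ᶠ (v₃ ⇒ᶠ v₄) ∷ v₂ ⇔ᶠ v₃ ∷ []) (v₁ ⇒ᶠ v₀)
      ([ ⌜ α ⌝ ] atom p ∷ [ ⌜ β ⌝ ] atom p ∷ Pre α ∷ Pre β ∷ atom p ∷ []) refl
      (simple-atomic-permanence α p ∷ simple-atomic-permanence β p ∷ IsSynBisim.pre bisim r ∷ [])

  -- The converse bisimulation supplies the implication [α]χ ⇒ [β]χ needed under the negation.
  transfers-¬ : ∀ {χ} → Transfers χ → Transfers (¬ₛ χ)
  transfers-¬ {χ} transfer bisim {α} {β} r =
    by-tautology (v₀ ⇔ᶠ (v₂ ⇒ᶠ ¬ᶠ v₄) ∷ v₁ ⇔ᶠ (v₃ ⇒ᶠ ¬ᶠ v₅) ∷ v₂ ⇔ᶠ v₃ ∷ v₄ ⇒ᶠ v₅ ∷ []) (v₁ ⇒ᶠ v₀)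
      ([ ⌜ α ⌝ ] (¬ₛ χ) ∷ [ ⌜ β ⌝ ] (¬ₛ χ) ∷ Pre α ∷ Pre β ∷ [ ⌜ α ⌝ ] χ ∷ [ ⌜ β ⌝ ] χ ∷ []) refl
      (simple-partial-functionality α χ ∷ simple-partial-functionality β χ
       ∷ IsSynBisim.pre bisim r ∷ transfer (converse bisim) r ∷ [])

  transfers-⋀ : ∀ {φ ψ} → Transfers φ → Transfers ψ → Transfers (φ ⋀ ψ)
  transfers-⋀ {φ} {ψ} transferφ transferψ bisim {α} {β} r =
    by-tautology (v₀ ⇒ᶠ v₁ ∷ v₀ ⇒ᶠ v₂ ∷ v₁ ⇒ᶠ v₃ ∷ v₂ ⇒ᶠ v₄ ∷ v₃ ∧ᶠ v₄ ⇒ᶠ v₅ ∷ []) (v₀ ⇒ᶠ v₅)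
      ([ ⌜ β ⌝ ] (φ ⋀ ψ) ∷ [ ⌜ β ⌝ ] φ ∷ [ ⌜ β ⌝ ] ψ ∷ [ ⌜ α ⌝ ] φ ∷ [ ⌜ α ⌝ ] ψ ∷ [ ⌜ α ⌝ ] (φ ⋀ ψ) ∷ []) refl
      ([]-mono ⌜ β ⌝ (by-tautology [] (v₀ ∧ᶠ v₁ ⇒ᶠ v₀) (φ ∷ ψ ∷ []) refl [])
       ∷ []-mono ⌜ β ⌝ (by-tautology [] (v₀ ∧ᶠ v₁ ⇒ᶠ v₁) (φ ∷ ψ ∷ []) refl [])
       ∷ transferφ bisim r ∷ transferψ bisim r ∷ []-⋀ ⌜ α ⌝ φ ψ ∷ [])

  transfers-□ : ∀ A {χ} → Transfers χ → Transfers (□ A χ)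
  transfers-□ A {χ} transfer bisim {α} {β} r = simple-action-knowledge⇐ α A χ step
    where
      open IsSynBisim bisim
      step : ∀ {α′} → α ⟶[ A ] α′ → ⊢ (([ ⌜ β ⌝ ] □ A χ) ⋀ Pre α) ⇒ □ A ([ ⌜ α′ ⌝ ] χ)
      step {α′} p with forth r A α′ p
      ... | β′ , q , r′ =
        by-tautology (v₀ ∧ᶠ v₂ ⇒ᶠ v₃ ∷ v₁ ⇔ᶠ v₂ ∷ v₃ ⇒ᶠ v₄ ∷ []) (v₀ ∧ᶠ v₁ ⇒ᶠ v₄)
          ([ ⌜ β ⌝ ] □ A χ ∷ Pre α ∷ Pre β ∷ □ A ([ ⌜ β′ ⌝ ] χ) ∷ □ A ([ ⌜ α′ ⌝ ] χ) ∷ []) refl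
          (simple-action-knowledge⇒ q χ ∷ pre r ∷ □-mono A (transfer bisim r′) ∷ [])

  data Appended (R : SAct → SAct → Set) (θs : Vec Sen n) : SAct → SAct → Set where
    append : ∀ {α β} → R α β → ∀ j → Appended R θs (α ⨟ act j θs) (β ⨟ act j θs)

  appended-bisim : ∀ {R} θs → (∀ j → Transfers (¬ₛ lookup θs j)) → IsSynBisim R →
                   IsSynBisim (Appended R θs)
  appended-bisim {R} θs transfer bisim = record { pre = pre′ ; forth = forth′ ; back = back′ }
    where
      open IsSynBisim bisim
      pre′ : ∀ {α β} → Appended R θs α β → ⊢ Pre α ⇔ Pre β
      pre′ (append {α} {β} r j) =
        by-tautology (v₁ ⇒ᶠ v₀ ∷ v₀ ⇒ᶠ v₁ ∷ []) (¬ᶠ v₀ ⇔ᶠ ¬ᶠ v₁)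
          ([ ⌜ α ⌝ ] (¬ₛ lookup θs j) ∷ [ ⌜ β ⌝ ] (¬ₛ lookup θs j) ∷ []) refl
          (transfer j bisim r ∷ transfer j (converse bisim) r ∷ [])
      forth′ : ∀ {α β} → Appended R θs α β → ∀ A α′ → α ⟶[ A ] α′ →
               ∃[ β′ ] (β ⟶[ A ] β′ × Appended R θs α′ β′)
      forth′ (append r j) A _ (seq→ p (act→ e)) with forth r A _ p
      ... | β′ , q , r′ = _ , seq→ q (act→ e) , append r′ _
      back′ : ∀ {α β} → Appended R θs α β → ∀ A β′ → β ⟶[ A ] β′ →
              ∃[ α′ ] (α ⟶[ A ] α′ × Appended R θs α′ β′)
      back′ (append r j) A _ (seq→ q (act→ e)) with back r A _ q
      ... | α′ , p , r′ = _ , seq→ p (act→ e) , append r′ _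

  -- [α][σᵢθ⃗]ψ is [α ; σᵢθ⃗]ψ, and appending σᵢθ⃗ to related actions keeps them related.
  transfers-act : ∀ i θs {ψ} → (∀ j → Transfers (¬ₛ lookup θs j)) → Transfers ψ →
                  Transfers ([ act i θs ] ψ)
  transfers-act i θs {ψ} transferθ transferψ bisim {α} {β} r =
    ⇒-trans (⇔-to (composition ⌜ β ⌝ (act i θs) ψ))
      (⇒-trans (transferψ (appended-bisim θs transferθ bisim) (append r i))
               (⇔-from (composition ⌜ α ⌝ (act i θs) ψ)))

  -- Among actions of one shape the index list determines the action, so links (pairs γ R δ
  -- shaped like α and β) are compared by their key, and only finitely many keys occur.
  module CommonKnowledge {R} (bisim : IsSynBisim R) (C : List Agents) {χ} (transfer : Transfers χ)
                         {α β} (α~β : R α β) where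
    open IsSynBisim bisim

    record Link : Set where
      field
        left right  : SAct
        related     : R left right
        left-shape  : SameShape α left
        right-shape : SameShape β right
    open Link

    _≟ᵢ_ : DecidableEquality (List (Fin n))
    _≟ᵢ_ = ≡-dec Fin._≟_

    key : Link → List (Fin n) × List (Fin n)
    key l = indices (left l) , indices (right l)

    follow : (l : Link) {A : Agents} {γ : SAct} → left l ⟶[ A ] γ → Link
    follow l {A} {γ} p = record
      { left = γ ; right = proj₁ δ′ ; related = proj₂ (proj₂ δ′)
      ; left-shape = SameShape-trans (left-shape l) (⟶⇒SameShape p)
      ; right-shape = SameShape-trans (right-shape l) (⟶⇒SameShape (proj₁ (proj₂ δ′))) }
      where δ′ = forth (related l) A γ p

    follow-step : (l : Link) {A : Agents} {γ : SAct} (p : left l ⟶[ A ] γ) →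
                  right l ⟶[ A ] right (follow l p)
    follow-step l {A} {γ} p = proj₁ (proj₂ (forth (related l) A γ p))

    next : Link → List Link
    next l = concatMap (λ A → mapWith∈ (successors A (left l)) (follow l ∘ successors-sound)) C

    follow-∈-next : ∀ {l A γ} → A ∈ C → (p : left l ⟶[ A ] γ) →
                    follow l (successors-sound (successors-complete p)) ∈ next l
    follow-∈-next {l} A∈C p =
      ∈-concatMap⁺ _ (lose A∈C (∈-mapWith∈ (follow l ∘ successors-sound) (successors-complete p)))

    open KeyClosure (×-≡-dec _≟ᵢ_ _≟ᵢ_) key next

    start : Link
    start = record { related = α~β ; left-shape = SameShape-refl α ; right-shape = SameShape-refl β }

    closure : ∃[ S ] (start ∈ S × KeyClosed S)
    closure = keyClosure (cartesianProduct (map indices (variants α)) (map indices (variants β)))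
      (λ l → ∈-cartesianProduct⁺ (∈-map⁺ indices (variants-complete (left-shape l)))
                                 (∈-map⁺ indices (variants-complete (right-shape l))))
      start

    S : List Link
    S = proj₁ closure

    target : Link → Sen
    target l = [ ⌜ right l ⌝ ] □* C χ

    linksAt : SAct → List Link
    linksAt γ = filter (λ l → indices (left l) ≟ᵢ indices γ) S

    Φ : SAct → Sen
    Φ γ = ⋁ₗ (map target (linksAt γ))

    Φ-intro : ∀ γ {l} → l ∈ S → indices (left l) ≡ indices γ → ⊢ target l ⇒ Φ γ
    Φ-intro γ l∈ eq = ⋁ₗ-intro (∈-map⁺ target (∈-filter⁺ (λ l → indices (left l) ≟ᵢ _) l∈ eq))

    Φ-elim : ∀ {γ ψ} → (∀ {l} → l ∈ S → left l ≡ γ → ⊢ target l ⇒ ψ) → α ⟶*[ C ] γ → ⊢ Φ γ ⇒ ψ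
    Φ-elim {γ} h reach = ⋁ₗ-elim _ λ φ∈ → case (∈-map⁻ target φ∈)
      where
        case : ∀ {φ} → ∃[ l ] (l ∈ linksAt γ × φ ≡ target l) → ⊢ φ ⇒ _
        case (l , l∈ , refl) = let l∈S , eq = ∈-filter⁻ (λ l → indices (left l) ≟ᵢ _) l∈ in
          h l∈S (indices-injective (SameShape-trans (SameShape-sym (left-shape l)) (⟶*⇒SameShape reach)) eq)

    initial : ⊢ ([ ⌜ β ⌝ ] □* C χ) ⇒ Φ α
    initial = Φ-intro α (proj₁ (proj₂ closure)) refl

    sound : ∀ γ → α ⟶*[ C ] γ → ⊢ Φ γ ⇒ ([ ⌜ γ ⌝ ] χ)
    sound γ = Φ-elim λ { {l} _ refl →
      ⇒-trans ([]-mono ⌜ right l ⌝ (□*-elim C χ)) (transfer bisim (related l)) }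

    invariant : ∀ γ γ′ A → α ⟶*[ C ] γ → A ∈ C → γ ⟶[ A ] γ′ → ⊢ (Φ γ ⋀ Pre γ) ⇒ □ A (Φ γ′)
    invariant γ γ′ A reach A∈C p =
      by-tautology (v₀ ⇒ᶠ v₁ ⇒ᶠ v₂ ∷ []) (v₀ ∧ᶠ v₁ ⇒ᶠ v₂) (Φ γ ∷ Pre γ ∷ □ A (Φ γ′) ∷ []) refl
        (Φ-elim step reach ∷ [])
      where
        step : ∀ {l} → l ∈ S → left l ≡ γ → ⊢ target l ⇒ (Pre γ ⇒ □ A (Φ γ′))
        step {l} l∈S refl =
          by-tautology (v₀ ⇒ᶠ v₁ ∷ v₂ ⇔ᶠ v₃ ∷ v₁ ∧ᶠ v₃ ⇒ᶠ v₄ ∷ v₄ ⇒ᶠ v₅ ∷ []) (v₀ ⇒ᶠ v₂ ⇒ᶠ v₅)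
            (target l ∷ [ ⌜ right l ⌝ ] □ A (□* C χ) ∷ Pre γ ∷ Pre (right l) ∷ □ A (target l′)
              ∷ □ A (Φ γ′) ∷ []) refl
            ([]-mono ⌜ right l ⌝ (□*-unfold χ A∈C) ∷ pre (related l)
             ∷ simple-action-knowledge⇒ (follow-step l p′) (□* C χ) ∷ □-mono A l′⇒Φ ∷ [])
          where
            p′ = successors-sound (successors-complete p)
            l′ = follow l p′
            l′⇒Φ : ⊢ target l′ ⇒ Φ γ′
            l′⇒Φ with proj₂ (proj₂ closure) l∈S (follow-∈-next A∈C p)
            ... | s , s∈S , same-key =
              subst (λ δ → ⊢ [ ⌜ δ ⌝ ] □* C χ ⇒ Φ γ′)
                (indices-injective (SameShape-trans (SameShape-sym (right-shape s)) (right-shape l′))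
                                   (cong proj₂ same-key))
                (Φ-intro γ′ s∈S (cong proj₁ same-key))

    result : ⊢ ([ ⌜ β ⌝ ] □* C χ) ⇒ ([ ⌜ α ⌝ ] □* C χ)
    result = ⇒-trans initial (action-rule α χ C Φ sound invariant)

  transfers-□* : ∀ C {χ} → Transfers χ → Transfers (□* C χ)
  transfers-□* C transfer bisim r = CommonKnowledge.result bisim C transfer r

  mutual
    size : Sen → ℕ
    size ⊤ₛ        = 1
    size (atom _)  = 1
    size (¬ₛ φ)    = suc (size φ)
    size (φ ⋀ ψ)   = suc (size φ + size ψ)
    size (□ _ φ)   = suc (size φ)
    size (□* _ φ)  = suc (size φ)
    size ([ π ] φ) = suc (sizeₚ π + size φ)

    -- Sequencing weighs one more than its parts, so that [π][ρ]ψ is smaller than [π ; ρ]ψ.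
    sizeₚ : Prog → ℕ
    sizeₚ skip       = 1
    sizeₚ crash      = 1
    sizeₚ (act _ θs) = suc (sizeᵥ θs)
    sizeₚ (π ∪ ρ)    = suc (sizeₚ π + sizeₚ ρ)
    sizeₚ (π ⨟ ρ)    = suc (suc (sizeₚ π + sizeₚ ρ))

    sizeᵥ : ∀ {k} → Vec Sen k → ℕ
    sizeᵥ []       = 0
    sizeᵥ (θ ∷ θs) = size θ + sizeᵥ θs

  size-lookup : ∀ {k} (θs : Vec Sen k) j → size (lookup θs j) ≤ sizeᵥ θs
  size-lookup (θ ∷ θs) zero    = m≤m+n (size θ) (sizeᵥ θs)
  size-lookup (θ ∷ θs) (suc j) = ≤-trans (size-lookup θs j) (m≤n+m (sizeᵥ θs) (size θ))

  transfers : ∀ φ → Acc _<_ (size φ) → Transfers φ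
  transfers ⊤ₛ       _         = transfers-theorem (taut λ v → refl)
  transfers (atom p) _         = transfers-atom p
  transfers (¬ₛ χ)   (acc rec) = transfers-¬ (transfers χ (rec ≤-refl))
  transfers (φ ⋀ ψ)  (acc rec) = transfers-⋀ (transfers φ (rec (s≤s (m≤m+n (size φ) (size ψ)))))
                                            (transfers ψ (rec (s≤s (m≤n+m (size ψ) (size φ)))))
  transfers (□ A χ)  (acc rec) = transfers-□ A (transfers χ (rec ≤-refl))
  transfers (□* C χ) (acc rec) = transfers-□* C (transfers χ (rec ≤-refl))
  transfers ([ skip ] ψ)  (acc rec) = transfers-⇔ (skip-ax ψ) (transfers ψ (rec (s≤s (n≤1+n (size ψ)))))
  transfers ([ crash ] ψ) _         = transfers-theorem ([crash] ψ)
  transfers ([ π ∪ ρ ] ψ) (acc rec) = transfers-⇔ (choice π ρ ψ) (transfers-⋀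
    (transfers ([ π ] ψ) (rec (s≤s (s≤s (+-monoˡ-≤ (size ψ) (m≤m+n (sizeₚ π) (sizeₚ ρ)))))))
    (transfers ([ ρ ] ψ) (rec (s≤s (s≤s (+-monoˡ-≤ (size ψ) (m≤n+m (sizeₚ ρ) (sizeₚ π))))))))
  transfers ([ π ⨟ ρ ] ψ) (acc rec) = transfers-⇔ (⇔-sym (composition π ρ ψ))
    (transfers ([ π ] ([ ρ ] ψ)) (rec (s≤s (s≤s (≤-reflexive
      (trans (+-suc (sizeₚ π) (sizeₚ ρ + size ψ)) (cong suc (sym (+-assoc (sizeₚ π) (sizeₚ ρ) (size ψ))))))))))
  transfers ([ act i θs ] ψ) (acc rec) = transfers-act i θs
    (λ j → transfers (¬ₛ lookup θs j) (rec (s≤s (s≤s (≤-trans (size-lookup θs j) (m≤m+n (sizeᵥ θs) (size ψ)))))))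
    (transfers ψ (rec (s≤s (m≤n+m (size ψ) (suc (sizeᵥ θs))))))

  every-sentence-transfers : ∀ φ → Transfers φ
  every-sentence-transfers φ = transfers φ (<-wellFounded (size φ))

mainTheorem13 : (AtSen Agents : Set) (Sig : Signature Agents) →
    let open L₁ AtSen Agents Sig in
    (α β : SAct) → α ≡ₛ β → (φ : Sen) → ⊢ ([ ⌜ α ⌝ ] φ) ⇔ ([ ⌜ β ⌝ ] φ)
mainTheorem13 AtSen Agents Sig α β (R , bisim , α~β) φ =
  ⇔-intro (every-sentence-transfers φ (converse bisim) α~β) (every-sentence-transfers φ bisim α~β)
  where open Invariance AtSen Agents Sig
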